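{- Let $n\ge 3$ and $S\subseteq[n-1]$. Then $$cp_n(S\cup\{n\}) = (n-2-2|S|)\,cp_{n-1}(S) + \sum_{j\notin S,\ j<n} 2\,cp_{n-1}(S\cup\{j\}),$$ where the sum runs over $j\in[n-1]\setminus S$.
   Context: For integers $a \le b$, $[a,b]=\{a,a+1,\dots,b\}$, $[a,b]=\emptyset$ if $a>b$, and $[n]=[1,n]$. For $m\ge1$, $\mathfrak{S}_m$ is the set of permutations of $[m]$, written in one-line form $\sigma=(\sigma(1)\cdots\sigma(m))$. The circular peak set of $\sigma\in\mathfrak{S}_m$ is $CP(\sigma)=\{\sigma(i) : 2\le i\le m-1,\ \sigma(i-1)<\sigma(i)>\sigma(i+1)\}$. For $S\subseteq[m]$, $CP_m(S)=\{\sigma\in\mathfrak{S}_m : CP(\sigma)=S\}$ and $cp_m(S)=|CP_m(S)|$. -}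

module Defs where

open import Data.Nat using (ℕ; zero; suc)
open import Data.Fin using (Fin; _<?_)
open import Data.Fin.Properties using () renaming (_≟_ to _≟ᶠ_)
open import Data.Fin.Subset using (Subset; ⊥; ⁅_⁆; _∪_)
open import Data.Bool.Properties using () renaming (_≟_ to _≟ᵇ_)
open import Data.List using (List; []; _∷_; [_]; map; concatMap; filter; length; allFin)
open import Data.Vec using (Vec; toList) renaming ([] to []ᵥ; _∷_ to _∷ᵥ_)
open import Data.Vec.Properties using (≡-dec)
open import Data.Product using (_×_)
open import Relation.Nullary.Decidable using (Dec; does; _×-dec_)
open import Data.Bool using (if_then_else_)
open import Relation.Binary.PropositionalEquality using (_≡_)
import Data.List.Relation.Unary.Unique.DecPropositional as UniqueDec

-- Convention: the value i ∈ [m] is represented by the element (i - 1) of Fin m,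
-- so the order of values is the order on Fin m.  A subset of [m] is a
-- Data.Fin.Subset m.

words : (m k : ℕ) → List (Vec (Fin m) k)
words m zero    = [ []ᵥ ]
words m (suc k) = concatMap (λ w → map (λ x → x ∷ᵥ w) (allFin m)) (words m k)

perms : (m : ℕ) → List (Vec (Fin m) m)
perms m = filter (λ σ → UniqueDec.unique? (_≟ᶠ_ {m}) (toList σ)) (words m m)

peaksAfter : {m : ℕ} → Fin m → List (Fin m) → List (Fin m)
peaksAfter a []             = []
peaksAfter a (b ∷ [])       = []
peaksAfter a (b ∷ c ∷ rest) =
  if does ((a <? b) ×-dec (c <? b))
  then b ∷ peaksAfter b (c ∷ rest)
  else peaksAfter b (c ∷ rest)

peakValues : {m : ℕ} → List (Fin m) → List (Fin m)
peakValues []       = []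
peakValues (a ∷ as) = peaksAfter a as

toSubset : {m : ℕ} → List (Fin m) → Subset m
toSubset []       = ⊥
toSubset (v ∷ vs) = ⁅ v ⁆ ∪ toSubset vs

CP : {m : ℕ} → Vec (Fin m) m → Subset m
CP σ = toSubset (peakValues (toList σ))

cp : (m : ℕ) → Subset m → ℕ
cp m S = length (filter (λ σ → ≡-dec _≟ᵇ_ (CP σ) S) (perms m))

-- Every permutation of [n] arises exactly once by inserting the value n into a permutation τ of
-- [n-1].  Inserted at either end, n is not a peak; inserted between adjacent entries a and b of τ
-- it becomes a peak, and a and b, which now have n as a neighbour, cease to be peaks, so that
-- CP(σ) = (CP(τ) ∖ {a, b}) ∪ {n}.  Hence cp_n(S ∪ {n}) counts pairs of a permutation τ of [n-1]
-- and an adjacent pair {a, b} of τ with CP(τ) ∖ {a, b} = S.  Peaks are interior and never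
-- adjacent, so each peak lies in exactly two of the n - 2 adjacent pairs.  If CP(τ) = S, the
-- n - 2 - 2|S| pairs free of peaks qualify; if CP(τ) = S ∪ {j} with j ∉ S, the two pairs
-- containing j qualify; otherwise none does.

module Submission where

open import Defs
open import Data.Nat using (ℕ; suc; _≤_)
open import Data.Integer using (ℤ; +_; _+_; _-_; _*_)
open import Data.Fin using (Fin)
open import Data.Fin.Subset using (Subset; ⁅_⁆; _∪_; ∣_∣; inside)
open import Data.Vec using (_∷ʳ_)
open import Data.List using (map; allFin; foldr)
open import Data.Fin.Subset.Properties using (_∈?_)
open import Relation.Nullary.Decidable using (does)
open import Data.Bool using (if_then_else_)
open import Relation.Binary.PropositionalEquality using (_≡_)

open import Data.Bool using (true; false)
open import Data.Bool.Properties using () renaming (_≟_ to _≟ᵇ_)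
open import Data.Empty using (⊥; ⊥-elim)
open import Data.Fin using (zero; suc; _<_; _<?_; inject₁; fromℕ; toℕ; lower₁)
import Data.Fin as Fin
open import Data.Fin.Properties
  using (toℕ-injective; toℕ-fromℕ; toℕ-inject₁; inject₁-injective; inject₁-lower₁; fromℕ≢inject₁; inject₁ℕ<)
  renaming (_≟_ to _≟ᶠ_)
open import Data.Fin.Subset using (_─_; outside) renaming (_-_ to _∖_; _∈_ to _∈ₛ_; _∉_ to _∉ₛ_)
open import Data.Fin.Subset.Properties
  using (⊆-antisym; p─q⊆p; p─x─y≡p─y─x; x∈p∧x≢y⇒x∈p-y; x∈p∪q⁻; x∈p∪q⁺; x∈⁅x⁆; x∈⁅y⁆⇒x≡y; ∉⊥)
open import Data.Integer using (-_)
import Data.Integer.Properties as ℤ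
open import Algebra.Properties.CommutativeSemigroup ℤ.+-commutativeSemigroup using (interchange; x∙yz≈y∙xz)
open import Data.Integer.Solver using (module +-*-Solver)
open import Data.List using (List; []; _∷_; [_]; _++_; filter; length; tabulate; cartesianProductWith; concatMap)
open import Data.List.Membership.Propositional using (_∈_; _∉_)
open import Data.List.Membership.Propositional.Properties
  using (∈-allFin; ∈-filter⁺; ∈-filter⁻; ∈-map⁻; ∈-++⁺ʳ; ∈-cartesianProductWith⁺; ∈-cartesianProductWith⁻)
open import Data.List.Membership.Propositional.Properties.WithK using (unique∧set⇒bag)
open import Data.List.Properties using (map-++; ++-assoc; map-tabulate; filter-notAll; length-tabulate)
open import Data.List.Relation.Binary.BagAndSetEquality using (∼bag⇒↭)
open import Data.List.Relation.Binary.Permutation.Propositional as ↭ using (_↭_; ↭-sym; ↭⇒↭ₛ)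
open import Data.List.Relation.Binary.Permutation.Propositional.Properties using (∈-resp-↭; ↭-length)
import Data.List.Relation.Binary.Permutation.Setoid.Properties as ↭ₛ
open import Data.List.Relation.Unary.All as All using (All; []; _∷_)
open import Data.List.Relation.Unary.Any as Any using (Any; here; there; any?)
open import Data.List.Relation.Unary.Unique.Propositional using (Unique; []; _∷_)
import Data.List.Relation.Unary.Unique.Propositional.Properties as Unique
import Data.List.Relation.Unary.Unique.DecPropositional as UniqueDec
import Data.Nat as ℕ
open import Data.Nat using (s≤s)
import Data.Nat.Properties as ℕ
open import Data.Product using (_×_; _,_; proj₁; proj₂; ∃; ∃₂)
open import Data.Sum as Sum using (_⊎_; inj₁; inj₂; [_,_]′)
open import Data.Vec using (Vec; toList; insertAt; here; there) renaming ([] to []ᵥ; _∷_ to _∷ᵥ_; map to mapᵥ)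
open import Data.Vec.Properties using (≡-dec; ∷-injective; ∷ʳ-injectiveˡ; toList-map; length-toList)
open import Function using (_∘_; _⇔_; mk⇔; Equivalence; case_of_)
open import Level using (Level)
open import Relation.Binary.PropositionalEquality
  using (setoid; refl; sym; trans; cong; cong₂; subst; subst₂; _≢_; ≢-sym; module ≡-Reasoning)
open import Relation.Nullary using (¬_; Dec; yes; no)
open import Relation.Nullary.Decidable using (_×-dec_)
open import Relation.Unary using (Decidable)

private
  variable
    ℓ ℓ′ : Level
    A : Set ℓ
    B : Set ℓ′

∑ : List A → (A → ℤ) → ℤ
∑ xs f = foldr _+_ (+ 0) (map f xs)

∑-++ : (xs ys : List A) (f : A → ℤ) → ∑ (xs ++ ys) f ≡ ∑ xs f + ∑ ys f
∑-++ []       ys f = sym (ℤ.+-identityˡ _)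
∑-++ (x ∷ xs) ys f = trans (cong (_+_ (f x)) (∑-++ xs ys f)) (sym (ℤ.+-assoc (f x) _ _))

∑-cong : (xs : List A) {f g : A → ℤ} → (∀ x → x ∈ xs → f x ≡ g x) → ∑ xs f ≡ ∑ xs g
∑-cong []       f≗g = refl
∑-cong (x ∷ xs) f≗g = cong₂ _+_ (f≗g x (here refl)) (∑-cong xs (λ y y∈xs → f≗g y (there y∈xs)))

∑-distrib-+ : (xs : List A) (f g : A → ℤ) → ∑ xs (λ x → f x + g x) ≡ ∑ xs f + ∑ xs g
∑-distrib-+ []       f g = refl
∑-distrib-+ (x ∷ xs) f g =
  trans (cong (_+_ (f x + g x)) (∑-distrib-+ xs f g)) (interchange (f x) (g x) (∑ xs f) (∑ xs g))

*-distribˡ-∑ : (c : ℤ) (xs : List A) (f : A → ℤ) → ∑ xs (λ x → c * f x) ≡ c * ∑ xs f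
*-distribˡ-∑ c []       f = sym (ℤ.*-zeroʳ c)
*-distribˡ-∑ c (x ∷ xs) f =
  trans (cong (_+_ (c * f x)) (*-distribˡ-∑ c xs f)) (sym (ℤ.*-distribˡ-+ c (f x) (∑ xs f)))

∑-zero : (xs : List A) → ∑ xs (λ _ → + 0) ≡ + 0
∑-zero []       = refl
∑-zero (x ∷ xs) = trans (ℤ.+-identityˡ _) (∑-zero xs)

∑-const : (xs : List A) (c : ℤ) → ∑ xs (λ _ → c) ≡ c * + length xs
∑-const xs c = begin
  ∑ xs (λ _ → c)          ≡⟨ ∑-cong xs (λ _ _ → sym (ℤ.*-identityʳ c)) ⟩
  ∑ xs (λ _ → c * + 1)    ≡⟨ *-distribˡ-∑ c xs (λ _ → + 1) ⟩
  c * ∑ xs (λ _ → + 1)    ≡⟨ cong (c *_) (count xs) ⟩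
  c * + length xs         ∎
  where
  open ≡-Reasoning
  count : (xs : List A) → ∑ xs (λ _ → + 1) ≡ + length xs
  count []       = refl
  count (x ∷ xs) = cong (_+_ (+ 1)) (count xs)

∑-map : (g : A → B) (xs : List A) (f : B → ℤ) → ∑ (map g xs) f ≡ ∑ xs (f ∘ g)
∑-map g []       f = refl
∑-map g (x ∷ xs) f = cong (_+_ (f (g x))) (∑-map g xs f)

∑-tabulate : ∀ {n} (g : Fin n → A) (f : A → ℤ) → ∑ (tabulate g) f ≡ ∑ (allFin n) (f ∘ g)
∑-tabulate g f = cong (foldr _+_ (+ 0)) (trans (map-tabulate g f) (sym (map-tabulate (λ i → i) (f ∘ g))))

∑-comm : (xs : List A) (ys : List B) (f : A → B → ℤ) →
  ∑ xs (λ x → ∑ ys (f x)) ≡ ∑ ys (λ y → ∑ xs (λ x → f x y))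
∑-comm []       ys f = sym (∑-zero ys)
∑-comm (x ∷ xs) ys f =
  trans (cong (_+_ (∑ ys (f x))) (∑-comm xs ys f)) (sym (∑-distrib-+ ys (f x) (λ y → ∑ xs (λ x → f x y))))

∑-cartesianProductWith : ∀ {ℓ″} {C : Set ℓ″} (g : A → B → C) (xs : List A) (ys : List B) (f : C → ℤ) →
  ∑ (cartesianProductWith g xs ys) f ≡ ∑ xs (λ x → ∑ ys (λ y → f (g x y)))
∑-cartesianProductWith g []       ys f = refl
∑-cartesianProductWith g (x ∷ xs) ys f =
  trans (∑-++ (map (g x) ys) _ f) (cong₂ _+_ (∑-map (g x) ys f) (∑-cartesianProductWith g xs ys f))

∑-↭ : {xs ys : List A} (f : A → ℤ) → xs ↭ ys → ∑ xs f ≡ ∑ ys f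
∑-↭ f ↭.refl                     = refl
∑-↭ f (↭.prep x xs↭ys)           = cong (_+_ (f x)) (∑-↭ f xs↭ys)
∑-↭ f (↭.swap {xs} {ys} x y xs↭ys) =
  trans (x∙yz≈y∙xz (f x) (f y) (∑ xs f)) (cong (λ s → f y + (f x + s)) (∑-↭ f xs↭ys))
∑-↭ f (↭.trans xs↭ys ys↭zs)      = trans (∑-↭ f xs↭ys) (∑-↭ f ys↭zs)

⟦_⟧ : ∀ {ℓ} {P : Set ℓ} → Dec P → ℤ
⟦ P? ⟧ = if does P? then + 1 else + 0

⟦⟧-no : ∀ {ℓ} {P : Set ℓ} (P? : Dec P) → ¬ P → ⟦ P? ⟧ ≡ + 0
⟦⟧-no (yes p) ¬p = ⊥-elim (¬p p)
⟦⟧-no (no _)  _  = refl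

⟦⟧-cong : ∀ {ℓ ℓ′} {P : Set ℓ} {Q : Set ℓ′} (P? : Dec P) (Q? : Dec Q) → P ⇔ Q → ⟦ P? ⟧ ≡ ⟦ Q? ⟧
⟦⟧-cong (yes _) (yes _) _   = refl
⟦⟧-cong (yes p) (no ¬q) P⇔Q = ⊥-elim (¬q (Equivalence.to P⇔Q p))
⟦⟧-cong (no ¬p) (yes q) P⇔Q = ⊥-elim (¬p (Equivalence.from P⇔Q q))
⟦⟧-cong (no _)  (no _)  _   = refl

length-filter≡∑ : ∀ {ℓ} {P : A → Set ℓ} (P? : Decidable P) (xs : List A) →
  + length (filter P? xs) ≡ ∑ xs (λ x → ⟦ P? x ⟧)
length-filter≡∑ P? []       = refl
length-filter≡∑ P? (x ∷ xs) with does (P? x)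
... | true  = cong (_+_ (+ 1)) (length-filter≡∑ P? xs)
... | false = trans (length-filter≡∑ P? xs) (sym (ℤ.+-identityˡ _))

Unique-head : {x : A} {xs : List A} → Unique (x ∷ xs) → x ∉ xs
Unique-head (x≢xs ∷ _) x∈xs = All.lookup x≢xs x∈xs refl

Unique-resp-↭ : {xs ys : List A} → xs ↭ ys → Unique xs → Unique ys
Unique-resp-↭ {A = A} xs↭ys = ↭ₛ.Unique-resp-↭ (setoid A) (↭⇒↭ₛ xs↭ys)

unique-set⇒↭ : {xs ys : List A} → Unique xs → Unique ys → (∀ {x} → x ∈ xs ⇔ x ∈ ys) → xs ↭ ys
unique-set⇒↭ xs! ys! xs≈ys = ∼bag⇒↭ (unique∧set⇒bag xs! ys! xs≈ys)

allFin-unique : ∀ n → Unique (allFin n)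
allFin-unique n = Unique.tabulate⁺ (λ i≡j → i≡j)

unique⇒↭allFin : ∀ {n} (xs : List (Fin n)) → Unique xs → length xs ≡ n → xs ↭ allFin n
unique⇒↭allFin {n} xs xs! ∣xs∣≡n =
  unique-set⇒↭ xs! (allFin-unique n) (λ {x} → mk⇔ (λ _ → ∈-allFin x) (λ _ → complete x))
  where
  -- filter (_∈ xs) (allFin n) is a rearrangement of xs, so it has n elements and omits nothing
  complete : ∀ x → x ∈ xs
  complete x with any? (x ≟ᶠ_) xs
  ... | yes x∈xs = x∈xs
  ... | no  x∉xs = ⊥-elim (ℕ.<-irrefl ∣filter∣≡n (filter-notAll _ (allFin n) missing))
    where
    ∈xs? : Decidable (_∈ xs)
    ∈xs? y = any? (y ≟ᶠ_) xs
    filter↭xs : filter ∈xs? (allFin n) ↭ xs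
    filter↭xs = unique-set⇒↭ (Unique.filter⁺ ∈xs? {allFin n} (allFin-unique n)) xs!
      (mk⇔ (proj₂ ∘ ∈-filter⁻ ∈xs? {xs = allFin n}) (λ y∈xs → ∈-filter⁺ ∈xs? (∈-allFin _) y∈xs))
    ∣filter∣≡n : length (filter ∈xs? (allFin n)) ≡ length (allFin n)
    ∣filter∣≡n = trans (↭-length filter↭xs) (trans ∣xs∣≡n (sym (length-tabulate (λ i → i))))
    missing : Any (¬_ ∘ (_∈ xs)) (allFin n)
    missing = Any.map (λ {refl x∈xs → x∉xs x∈xs}) (∈-allFin x)

adjacent : List A → List (A × A)
adjacent []           = []
adjacent (x ∷ [])     = []
adjacent (x ∷ y ∷ ys) = (x , y) ∷ adjacent (y ∷ ys)

last : A → List A → A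
last x []       = x
last x (y ∷ ys) = last y ys

last∈ : (x : A) (xs : List A) → last x xs ∈ x ∷ xs
last∈ x []       = here refl
last∈ x (y ∷ ys) = there (last∈ y ys)

adjacent-∈ˡ : ∀ {x y : A} w → (x , y) ∈ adjacent w → x ∈ w
adjacent-∈ˡ (a ∷ b ∷ w) (here refl) = here refl
adjacent-∈ˡ (a ∷ b ∷ w) (there xy∈) = there (adjacent-∈ˡ (b ∷ w) xy∈)

adjacent-∈ʳ : ∀ {x y a : A} w → (x , y) ∈ adjacent (a ∷ w) → y ∈ w
adjacent-∈ʳ (b ∷ w) (here refl) = here refl
adjacent-∈ʳ (b ∷ w) (there xy∈) = there (adjacent-∈ʳ w xy∈)

∑-adjacent-proj₂ : (x : A) (xs : List A) (f : A → ℤ) → ∑ (adjacent (x ∷ xs)) (f ∘ proj₂) ≡ ∑ xs f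
∑-adjacent-proj₂ x []       f = refl
∑-adjacent-proj₂ x (y ∷ ys) f = cong (_+_ (f y)) (∑-adjacent-proj₂ y ys f)

∑-adjacent-proj₁ : (x : A) (xs : List A) (f : A → ℤ) →
  ∑ (adjacent (x ∷ xs)) (f ∘ proj₁) + f (last x xs) ≡ ∑ (x ∷ xs) f
∑-adjacent-proj₁ x []       f = ℤ.+-comm (+ 0) (f x)
∑-adjacent-proj₁ x (y ∷ ys) f =
  trans (ℤ.+-assoc (f x) _ _) (cong (_+_ (f x)) (∑-adjacent-proj₁ y ys f))

splits : List A → List (List A × List A)
splits []       = [ ([] , []) ]
splits (x ∷ xs) = ([] , x ∷ xs) ∷ map (λ (u , v) → (x ∷ u , v)) (splits xs)

δ : ∀ {n} → Subset n → Subset n → ℤ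
δ P Q = ⟦ ≡-dec _≟ᵇ_ P Q ⟧

δ-≢ : ∀ {n} {P Q : Subset n} → P ≢ Q → δ P Q ≡ + 0
δ-≢ = ⟦⟧-no (≡-dec _≟ᵇ_ _ _)

δ-cong : ∀ {n n′} {P Q : Subset n} {P′ Q′ : Subset n′} → (P ≡ Q ⇔ P′ ≡ Q′) → δ P Q ≡ δ P′ Q′
δ-cong = ⟦⟧-cong (≡-dec _≟ᵇ_ _ _) (≡-dec _≟ᵇ_ _ _)

δ-cases : ∀ {n} (P Q : Subset n) → P ≡ Q ⊎ δ P Q ≡ + 0
δ-cases P Q with ≡-dec _≟ᵇ_ P Q
... | yes P≡Q = inj₁ P≡Q
... | no  _   = inj₂ refl

∣p∣≡∑ : ∀ {n} (p : Subset n) → + ∣ p ∣ ≡ ∑ (allFin n) (λ x → ⟦ x ∈? p ⟧)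
∣p∣≡∑ []ᵥ            = refl
∣p∣≡∑ (inside ∷ᵥ p)  = cong (_+_ (+ 1)) (trans (∣p∣≡∑ p) (sym (∑-tabulate Fin.suc (λ x → ⟦ x ∈? inside ∷ᵥ p ⟧))))
∣p∣≡∑ (outside ∷ᵥ p) =
  trans (∣p∣≡∑ p) (trans (sym (∑-tabulate Fin.suc (λ x → ⟦ x ∈? outside ∷ᵥ p ⟧))) (sym (ℤ.+-identityˡ _)))

x∈p─q⇒x∉q : ∀ {n} {x : Fin n} (p q : Subset n) → x ∈ₛ p ─ q → x ∉ₛ q
x∈p─q⇒x∉q (inside ∷ᵥ p) (outside ∷ᵥ q) here       ()
x∈p─q⇒x∉q (_      ∷ᵥ p) (_       ∷ᵥ q) (there x∈) (there x∈q) = x∈p─q⇒x∉q p q x∈ x∈q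

x∈p-y⇒x≢y : ∀ {n} {x y : Fin n} {p : Subset n} → x ∈ₛ p ∖ y → x ≢ y
x∈p-y⇒x≢y {x = x} {p = p} x∈ refl = x∈p─q⇒x∉q p ⁅ x ⁆ x∈ (x∈⁅x⁆ x)

x∈p-y⇒x∈p : ∀ {n} {x y : Fin n} {p : Subset n} → x ∈ₛ p ∖ y → x ∈ₛ p
x∈p-y⇒x∈p {y = y} {p} = p─q⊆p p ⁅ y ⁆

inject₁∈∷ʳ⁺ : ∀ {n} {x : Fin n} {p : Subset n} {s} → x ∈ₛ p → inject₁ x ∈ₛ p ∷ʳ s
inject₁∈∷ʳ⁺ here       = here
inject₁∈∷ʳ⁺ (there x∈) = there (inject₁∈∷ʳ⁺ x∈)

inject₁∈∷ʳ⁻ : ∀ {n} {x : Fin n} (p : Subset n) {s} → inject₁ x ∈ₛ p ∷ʳ s → x ∈ₛ p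
inject₁∈∷ʳ⁻ {x = zero}  (_ ∷ᵥ p) here       = here
inject₁∈∷ʳ⁻ {x = suc x} (_ ∷ᵥ p) (there x∈) = there (inject₁∈∷ʳ⁻ p x∈)

fromℕ∈∷ʳinside : ∀ {n} (p : Subset n) → fromℕ n ∈ₛ p ∷ʳ inside
fromℕ∈∷ʳinside []ᵥ      = here
fromℕ∈∷ʳinside (_ ∷ᵥ p) = there (fromℕ∈∷ʳinside p)

words-suc : (m k : ℕ) → words m (suc k) ≡ cartesianProductWith (λ w x → x ∷ᵥ w) (words m k) (allFin m)
words-suc m k = go (words m k)
  where
  go : ∀ ws → concatMap (λ w → map (_∷ᵥ w) (allFin m)) ws ≡ cartesianProductWith (λ w x → x ∷ᵥ w) ws (allFin m)
  go []       = refl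
  go (w ∷ ws) = cong (map (_∷ᵥ w) (allFin m) ++_) (go ws)

∈-words : (m k : ℕ) (w : Vec (Fin m) k) → w ∈ words m k
∈-words m ℕ.zero    []ᵥ      = here refl
∈-words m (suc k) (x ∷ᵥ w) rewrite words-suc m k =
  ∈-cartesianProductWith⁺ (λ w x → x ∷ᵥ w) (∈-words m k w) (∈-allFin x)

words-unique : (m k : ℕ) → Unique (words m k)
words-unique m ℕ.zero    = [] ∷ []
words-unique m (suc k) rewrite words-suc m k =
  Unique.cartesianProductWith⁺ (λ w x → x ∷ᵥ w) (λ e → proj₂ (∷-injective e) , proj₁ (∷-injective e))
    (words-unique m k) (allFin-unique m)

private
  isPerm? : ∀ {m} (σ : Vec (Fin m) m) → Dec (Unique (toList σ))
  isPerm? σ = UniqueDec.unique? _≟ᶠ_ (toList σ)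

perms-unique : ∀ m → Unique (perms m)
perms-unique m = Unique.filter⁺ isPerm? {words m m} (words-unique m m)

∈-perms⁺ : ∀ {m} {σ : Vec (Fin m) m} → Unique (toList σ) → σ ∈ perms m
∈-perms⁺ {m} {σ} σ! = ∈-filter⁺ isPerm? (∈-words m m σ) σ!

∈-perms⁻ : ∀ {m} {σ : Vec (Fin m) m} → σ ∈ perms m → Unique (toList σ)
∈-perms⁻ {m} σ∈ = proj₂ (∈-filter⁻ isPerm? {xs = words m m} σ∈)

perm↭allFin : ∀ {m} {σ : Vec (Fin m) m} → σ ∈ perms m → toList σ ↭ allFin m
perm↭allFin {σ = σ} σ∈ = unique⇒↭allFin (toList σ) (∈-perms⁻ σ∈) (length-toList σ)

cp≡∑δ : ∀ m (T : Subset m) → + cp m T ≡ ∑ (perms m) (λ σ → δ (CP σ) T)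
cp≡∑δ m T = length-filter≡∑ (λ σ → ≡-dec _≟ᵇ_ (CP σ) T) (perms m)

-- Inserting the maximal value

fromℕ⊎inject₁ : ∀ {m} (i : Fin (suc m)) → i ≡ fromℕ m ⊎ ∃ λ j → i ≡ inject₁ j
fromℕ⊎inject₁ {m} i with m ℕ.≟ toℕ i
... | yes m≡i = inj₁ (toℕ-injective (trans (sym m≡i) (sym (toℕ-fromℕ m))))
... | no  m≢i = inj₂ (lower₁ i m≢i , sym (inject₁-lower₁ i m≢i))

module _ {m : ℕ} where

  inject₁-mono-< : ∀ {x y : Fin m} → x < y → inject₁ x < inject₁ y
  inject₁-mono-< {x} {y} = subst₂ ℕ._<_ (sym (toℕ-inject₁ x)) (sym (toℕ-inject₁ y))

  inject₁-cancel-< : ∀ {x y : Fin m} → inject₁ x < inject₁ y → x < y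
  inject₁-cancel-< {x} {y} = subst₂ ℕ._<_ (toℕ-inject₁ x) (toℕ-inject₁ y)

  inject₁<fromℕ : (x : Fin m) → inject₁ x < fromℕ m
  inject₁<fromℕ x = subst (toℕ (inject₁ x) ℕ.<_) (sym (toℕ-fromℕ m)) (inject₁ℕ< x)

fromℕ∉map-inject₁ : ∀ {m} (xs : List (Fin m)) → fromℕ m ∉ map inject₁ xs
fromℕ∉map-inject₁ xs M∈ with _ , _ , M≡ ← ∈-map⁻ inject₁ M∈ = fromℕ≢inject₁ M≡

fromℕ∉mapᵥ-inject₁ : ∀ {m n} (v : Vec (Fin m) n) → fromℕ m ∉ toList (mapᵥ inject₁ v)
fromℕ∉mapᵥ-inject₁ v rewrite toList-map inject₁ v = fromℕ∉map-inject₁ (toList v)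

mapᵥ-inject₁-injective : ∀ {m n} {v w : Vec (Fin m) n} → mapᵥ inject₁ v ≡ mapᵥ inject₁ w → v ≡ w
mapᵥ-inject₁-injective {v = []ᵥ}     {[]ᵥ}     _ = refl
mapᵥ-inject₁-injective {v = x ∷ᵥ v} {y ∷ᵥ w} e =
  cong₂ _∷ᵥ_ (inject₁-injective (proj₁ (∷-injective e))) (mapᵥ-inject₁-injective (proj₂ (∷-injective e)))

lower-mapᵥ-inject₁ : ∀ {m n} (v : Vec (Fin (suc m)) n) → fromℕ m ∉ toList v → ∃ λ w → v ≡ mapᵥ inject₁ w
lower-mapᵥ-inject₁ []ᵥ       _   = []ᵥ , refl
lower-mapᵥ-inject₁ (x ∷ᵥ v) M∉ with fromℕ⊎inject₁ x | lower-mapᵥ-inject₁ v (M∉ ∘ there)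
... | inj₁ refl       | _          = ⊥-elim (M∉ (here refl))
... | inj₂ (y , refl) | w , refl   = y ∷ᵥ w , refl

insertAt-↭ : ∀ {n} (v : Vec A n) k x → toList (insertAt v k x) ↭ x ∷ toList v
insertAt-↭ v         zero    x = ↭.refl
insertAt-↭ (y ∷ᵥ v) (suc k) x = ↭.trans (↭.prep y (insertAt-↭ v k x)) (↭.swap y x ↭.refl)

insertAt-injective : ∀ {n} {x : A} (v w : Vec A n) i j → x ∉ toList v → x ∉ toList w →
  insertAt v i x ≡ insertAt w j x → v ≡ w × i ≡ j
insertAt-injective v         w         zero    zero    _   _   e = proj₂ (∷-injective e) , refl
insertAt-injective (y ∷ᵥ v) w         (suc i) zero    x∉v _   e = ⊥-elim (x∉v (here (sym (proj₁ (∷-injective e)))))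
insertAt-injective v         (y ∷ᵥ w) zero    (suc j) _   x∉w e = ⊥-elim (x∉w (here (proj₁ (∷-injective e))))
insertAt-injective (y ∷ᵥ v) (z ∷ᵥ w) (suc i) (suc j) x∉v x∉w e
  with refl ← proj₁ (∷-injective e)
  with refl , refl ← insertAt-injective v w i j (x∉v ∘ there) (x∉w ∘ there) (proj₂ (∷-injective e))
  = refl , refl

∑-insertAt : (f : A → B) {n : ℕ} (v : Vec A n) (x : B) (F : List B → ℤ) →
  ∑ (allFin (suc n)) (λ k → F (toList (insertAt (mapᵥ f v) k x)))
    ≡ ∑ (splits (toList v)) (λ (u , w) → F (map f u ++ x ∷ map f w))
∑-insertAt f []ᵥ       x F = refl
∑-insertAt f (y ∷ᵥ v) x F = cong₂ _+_ (cong (λ w → F (x ∷ f y ∷ w)) (toList-map f v)) (begin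
  ∑ (tabulate suc) (λ k → F (toList (insertAt (mapᵥ f (y ∷ᵥ v)) k x)))
    ≡⟨ ∑-tabulate Fin.suc (λ k → F (toList (insertAt (mapᵥ f (y ∷ᵥ v)) k x))) ⟩
  ∑ (allFin _) (λ k → F (f y ∷ toList (insertAt (mapᵥ f v) k x)))
    ≡⟨ ∑-insertAt f v x (F ∘ (f y ∷_)) ⟩
  ∑ (splits (toList v)) (λ (u , w) → F (f y ∷ map f u ++ x ∷ map f w))
    ≡⟨ ∑-map (λ (u , w) → (y ∷ u , w)) (splits (toList v)) _ ⟨
  ∑ (map (λ (u , w) → (y ∷ u , w)) (splits (toList v))) (λ (u , w) → F (map f u ++ x ∷ map f w)) ∎)
  where open ≡-Reasoning

insertMax : ∀ {m n} → Vec (Fin m) n → Fin (suc n) → Vec (Fin (suc m)) (suc n)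
insertMax {m} v k = insertAt (mapᵥ inject₁ v) k (fromℕ m)

insertMax↭ : ∀ {m n} (v : Vec (Fin m) n) k → toList (insertMax v k) ↭ fromℕ m ∷ map inject₁ (toList v)
insertMax↭ {m} v k =
  subst (λ xs → toList (insertMax v k) ↭ fromℕ m ∷ xs) (toList-map inject₁ v) (insertAt-↭ (mapᵥ inject₁ v) k _)

insertMax-injective : ∀ {m n} {v w : Vec (Fin m) n} {i j} → insertMax v i ≡ insertMax w j → v ≡ w × i ≡ j
insertMax-injective {v = v} {w} {i} {j} e
  with v′≡w′ , i≡j ← insertAt-injective _ _ i j (fromℕ∉mapᵥ-inject₁ v) (fromℕ∉mapᵥ-inject₁ w) e
  = mapᵥ-inject₁-injective v′≡w′ , i≡j

insertMax-unique : ∀ {m n} (v : Vec (Fin m) n) k → Unique (toList v) → Unique (toList (insertMax v k))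
insertMax-unique v k v! = Unique-resp-↭ (↭-sym (insertMax↭ v k))
  (All.tabulate (λ M∈ M≡ → fromℕ∉map-inject₁ (toList v) (subst (_∈ _) (sym M≡) M∈))
    ∷ Unique.map⁺ inject₁-injective v!)

insertMax-unique⁻ : ∀ {m n} (v : Vec (Fin m) n) k → Unique (toList (insertMax v k)) → Unique (toList v)
insertMax-unique⁻ v k σ! with _ ∷ v! ← Unique-resp-↭ (insertMax↭ v k) σ! = Unique.map⁻ v!

insertMax-surjective : ∀ {m n} (σ : Vec (Fin (suc m)) (suc n)) → Unique (toList σ) → fromℕ m ∈ toList σ →
  ∃₂ λ v k → σ ≡ insertMax v k
insertMax-surjective (x ∷ᵥ σ) σ! M∈ with fromℕ⊎inject₁ x
insertMax-surjective (x ∷ᵥ σ) σ! M∈ | inj₁ refl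
  with v , refl ← lower-mapᵥ-inject₁ σ (Unique-head σ!) = v , zero , refl
insertMax-surjective (x ∷ᵥ σ) σ! (here M≡x) | inj₂ (y , refl) = ⊥-elim (fromℕ≢inject₁ M≡x)
insertMax-surjective {n = ℕ.zero} (x ∷ᵥ []ᵥ) σ! (there ()) | inj₂ (y , refl)
insertMax-surjective {n = suc n} (x ∷ᵥ σ) (_ ∷ σ!) (there M∈σ) | inj₂ (y , refl)
  with v , k , refl ← insertMax-surjective σ σ! M∈σ = y ∷ᵥ v , suc k , refl

∑-perms-suc : ∀ m (F : Vec (Fin (suc m)) (suc m) → ℤ) →
  ∑ (perms (suc m)) F ≡ ∑ (perms m) (λ τ → ∑ (allFin (suc m)) (F ∘ insertMax τ))
∑-perms-suc m F = trans (∑-↭ F perms↭) (∑-cartesianProductWith insertMax (perms m) (allFin (suc m)) F)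
  where
  to : ∀ {σ} → σ ∈ perms (suc m) → σ ∈ cartesianProductWith insertMax (perms m) (allFin (suc m))
  to {σ} σ∈
    with v , k , refl ← insertMax-surjective σ (∈-perms⁻ σ∈) (∈-resp-↭ (↭-sym (perm↭allFin σ∈)) (∈-allFin _))
    = ∈-cartesianProductWith⁺ insertMax (∈-perms⁺ (insertMax-unique⁻ v k (∈-perms⁻ σ∈))) (∈-allFin k)

  from : ∀ {σ} → σ ∈ cartesianProductWith insertMax (perms m) (allFin (suc m)) → σ ∈ perms (suc m)
  from σ∈ with v , k , v∈ , _ , refl ← ∈-cartesianProductWith⁻ insertMax (perms m) (allFin (suc m)) σ∈
    = ∈-perms⁺ (insertMax-unique v k (∈-perms⁻ v∈))

  perms↭ : perms (suc m) ↭ cartesianProductWith insertMax (perms m) (allFin (suc m))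
  perms↭ = unique-set⇒↭ (perms-unique (suc m))
    (Unique.cartesianProductWith⁺ insertMax insertMax-injective (perms-unique m) (allFin-unique (suc m)))
    (mk⇔ to from)

-- Peaks

data Peak {n : ℕ} : List (Fin n) → Fin n → Set where
  here  : ∀ {a b c w} → a < b → c < b → Peak (a ∷ b ∷ c ∷ w) b
  there : ∀ {a w x} → Peak w x → Peak (a ∷ w) x

peakSet : ∀ {n} → List (Fin n) → Subset n
peakSet w = toSubset (peakValues w)

module _ {n : ℕ} where

  ∈-toSubset⁺ : {x : Fin n} {xs : List (Fin n)} → x ∈ xs → x ∈ₛ toSubset xs
  ∈-toSubset⁺ (here refl) = x∈p∪q⁺ (inj₁ (x∈⁅x⁆ _))
  ∈-toSubset⁺ (there x∈)  = x∈p∪q⁺ (inj₂ (∈-toSubset⁺ x∈))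

  ∈-toSubset⁻ : {x : Fin n} (xs : List (Fin n)) → x ∈ₛ toSubset xs → x ∈ xs
  ∈-toSubset⁻ []       x∈ = ⊥-elim (∉⊥ x∈)
  ∈-toSubset⁻ (v ∷ vs) x∈ with x∈p∪q⁻ ⁅ v ⁆ (toSubset vs) x∈
  ... | inj₁ x∈⁅v⁆ = here (x∈⁅y⁆⇒x≡y v x∈⁅v⁆)
  ... | inj₂ x∈vs  = there (∈-toSubset⁻ vs x∈vs)

  -- peaksAfter branches on `does`, which `with` cannot abstract, so the decision is passed explicitly
  private
    cons-if : ∀ {ℓ} {P : Set ℓ} → Dec P → Fin n → List (Fin n) → List (Fin n)
    cons-if P? y ys = if does P? then y ∷ ys else ys

    ∈-cons-if⁻ : ∀ {ℓ} {P : Set ℓ} (P? : Dec P) {x y ys} → x ∈ cons-if P? y ys → (P × x ≡ y) ⊎ x ∈ ys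
    ∈-cons-if⁻ (yes p) (here x≡y) = inj₁ (p , x≡y)
    ∈-cons-if⁻ (yes _) (there x∈) = inj₂ x∈
    ∈-cons-if⁻ (no _)  x∈         = inj₂ x∈

    ∈-cons-if⁺ : ∀ {ℓ} {P : Set ℓ} (P? : Dec P) {x y ys} → (P × x ≡ y) ⊎ x ∈ ys → x ∈ cons-if P? y ys
    ∈-cons-if⁺ (yes _) (inj₁ (_ , x≡y)) = here x≡y
    ∈-cons-if⁺ (no ¬p) (inj₁ (p , _))   = ⊥-elim (¬p p)
    ∈-cons-if⁺ (yes _) (inj₂ x∈)        = there x∈
    ∈-cons-if⁺ (no _)  (inj₂ x∈)        = x∈

  ∈-peaksAfter⁺ : ∀ a w {x : Fin n} → Peak (a ∷ w) x → x ∈ peaksAfter a w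
  ∈-peaksAfter⁺ a (b ∷ c ∷ w) (here a<b c<b) =
    ∈-cons-if⁺ ((a <? b) ×-dec (c <? b)) (inj₁ ((a<b , c<b) , refl))
  ∈-peaksAfter⁺ a (b ∷ c ∷ w) (there pk)     =
    ∈-cons-if⁺ ((a <? b) ×-dec (c <? b)) (inj₂ (∈-peaksAfter⁺ b (c ∷ w) pk))
  ∈-peaksAfter⁺ a []          (there ())
  ∈-peaksAfter⁺ a (b ∷ [])    (there (there ()))

  ∈-peaksAfter⁻ : ∀ a w {x : Fin n} → x ∈ peaksAfter a w → Peak (a ∷ w) x
  ∈-peaksAfter⁻ a (b ∷ c ∷ w) x∈ =
    [ (λ { ((a<b , c<b) , refl) → here a<b c<b }) , there ∘ ∈-peaksAfter⁻ b (c ∷ w) ]′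
      (∈-cons-if⁻ ((a <? b) ×-dec (c <? b)) x∈)

  ∈-peakSet⁺ : ∀ {w} {x : Fin n} → Peak w x → x ∈ₛ peakSet w
  ∈-peakSet⁺ {a ∷ w} pk = ∈-toSubset⁺ (∈-peaksAfter⁺ a w pk)

  ∈-peakSet⁻ : ∀ {w} {x : Fin n} → x ∈ₛ peakSet w → Peak w x
  ∈-peakSet⁻ {[]}    x∈ = ⊥-elim (∉⊥ x∈)
  ∈-peakSet⁻ {a ∷ w} x∈ = ∈-peaksAfter⁻ a w (∈-toSubset⁻ (peaksAfter a w) x∈)

  Peak-∈ : ∀ {w} {x : Fin n} → Peak w x → x ∈ w
  Peak-∈ (here _ _) = there (here refl)
  Peak-∈ (there pk) = there (Peak-∈ pk)

  Peak-∈-tail : ∀ {a w} {x : Fin n} → Peak (a ∷ w) x → x ∈ w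
  Peak-∈-tail (here _ _) = here refl
  Peak-∈-tail (there pk) = Peak-∈ pk

  Peak-∈-init : ∀ u {z x : Fin n} → Peak (u ++ [ z ]) x → x ∈ u
  Peak-∈-init (a ∷ b ∷ [])    (here _ _) = there (here refl)
  Peak-∈-init (a ∷ b ∷ c ∷ u) (here _ _) = there (here refl)
  Peak-∈-init (a ∷ u)         (there pk) = there (Peak-∈-init u pk)
  Peak-∈-init []              (there ())

  Peak-last : ∀ {h t} → Unique (h ∷ t) → ¬ Peak {n} (h ∷ t) (last h t)
  Peak-last {t = b ∷ c ∷ w} (_ ∷ b∉ ∷ _) (here _ _) = All.lookup b∉ (last∈ c w) refl
  Peak-last {t = []}        _            (there ())
  Peak-last {t = b ∷ w}     (_ ∷ bw!)    (there pk) = Peak-last bw! pk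

  Peak-left< : ∀ {w} {x y : Fin n} → Unique w → (y , x) ∈ adjacent w → Peak w x → y < x
  Peak-left< {a ∷ b ∷ w} _         (here refl) (here a<b _) = a<b
  Peak-left< {a ∷ b ∷ w} (_ ∷ bw!) (here refl) (there pk)   = ⊥-elim (Unique-head bw! (Peak-∈-tail pk))
  Peak-left< {a ∷ b ∷ w} (_ ∷ bw!) (there yx∈) (here _ _)   = ⊥-elim (Unique-head bw! (adjacent-∈ʳ w yx∈))
  Peak-left< {a ∷ b ∷ w} (_ ∷ bw!) (there yx∈) (there pk)   = Peak-left< bw! yx∈ pk

  Peak-right< : ∀ {w} {x y : Fin n} → Unique w → (x , y) ∈ adjacent w → Peak w x → y < x
  Peak-right< {a ∷ b ∷ w} (a∉ ∷ _)  (here refl)         (here _ _)   = ⊥-elim (All.lookup a∉ (here refl) refl)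
  Peak-right< {a ∷ b ∷ w} abw!      (here refl)         (there pk)   = ⊥-elim (Unique-head abw! (Peak-∈ pk))
  Peak-right< {a ∷ b ∷ w} _         (there (here refl)) (here _ c<b) = c<b
  Peak-right< {a ∷ b ∷ w} (_ ∷ bw!) (there (there xy∈)) (here _ _)   = ⊥-elim (Unique-head bw! (adjacent-∈ˡ w xy∈))
  Peak-right< {a ∷ b ∷ w} (_ ∷ bw!) (there xy∈)         (there pk)   = Peak-right< bw! xy∈ pk

  Peak-adjacent : ∀ {w} {x y : Fin n} → Unique w → (x , y) ∈ adjacent w → Peak w x → Peak w y → ⊥
  Peak-adjacent w! xy∈ pk-x pk-y = ℕ.<-asym (Peak-right< w! xy∈ pk-x) (Peak-left< w! xy∈ pk-y)

  module _ (M : Fin n) where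

    Peak-insert-max : ∀ pre {a b} post → a < M → b < M → Peak (pre ++ a ∷ M ∷ b ∷ post) M
    Peak-insert-max []        post a<M b<M = here a<M b<M
    Peak-insert-max (p ∷ pre) post a<M b<M = there (Peak-insert-max pre post a<M b<M)

    Peak-insert⁺ : ∀ pre {a b x} post → Peak (pre ++ a ∷ b ∷ post) x → x ≢ a → x ≢ b →
      Peak (pre ++ a ∷ M ∷ b ∷ post) x
    Peak-insert⁺ []                post (here _ _)      _   x≢b = ⊥-elim (x≢b refl)
    Peak-insert⁺ []                post (there pk)      _   _   = there (there pk)
    Peak-insert⁺ (p ∷ [])          post (here _ _)      x≢a _   = ⊥-elim (x≢a refl)
    Peak-insert⁺ (p ∷ q ∷ [])      post (here p<q a<q)  _   _   = here p<q a<q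
    Peak-insert⁺ (p ∷ q ∷ r ∷ pre) post (here p<q r<q)  _   _   = here p<q r<q
    Peak-insert⁺ (p ∷ pre)         post (there pk)      x≢a x≢b = there (Peak-insert⁺ pre post pk x≢a x≢b)

    Peak-insert⁻ : ∀ pre {a b x} post → Unique (pre ++ a ∷ b ∷ post) → a < M → b < M →
      Peak (pre ++ a ∷ M ∷ b ∷ post) x → x ≡ M ⊎ (Peak (pre ++ a ∷ b ∷ post) x × x ≢ a × x ≢ b)
    Peak-insert⁻ [] post _ _ _ (here _ _) = inj₁ refl
    Peak-insert⁻ [] post _ _ b<M (there (here M<b _)) = ⊥-elim (ℕ.<-asym M<b b<M)
    Peak-insert⁻ [] post (a≢ ∷ b≢ ∷ _) _ _ (there (there pk)) =
      inj₂ (there pk , ≢-sym (All.lookup a≢ (there x∈post)) , ≢-sym (All.lookup b≢ x∈post))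
      where x∈post = Peak-∈-tail pk
    Peak-insert⁻ (p ∷ []) post _ a<M _ (here _ M<a) = ⊥-elim (ℕ.<-asym M<a a<M)
    Peak-insert⁻ (p ∷ q ∷ []) post (_ ∷ q≢ ∷ _) _ _ (here p<q a<q) =
      inj₂ (here p<q a<q , All.lookup q≢ (here refl) , All.lookup q≢ (there (here refl)))
    Peak-insert⁻ (p ∷ q ∷ r ∷ pre) post (_ ∷ q≢ ∷ _) _ _ (here p<q r<q) =
      inj₂ (here p<q r<q , All.lookup q≢ (∈-++⁺ʳ (r ∷ pre) (here refl))
                         , All.lookup q≢ (∈-++⁺ʳ (r ∷ pre) (there (here refl))))
    Peak-insert⁻ (p ∷ pre) post (_ ∷ pre!) a<M b<M (there pk) =
      Sum.map₂ (λ (pk′ , x≢a , x≢b) → there pk′ , x≢a , x≢b) (Peak-insert⁻ pre post pre! a<M b<M pk)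

module _ {m n} {f : Fin m → Fin n} (f-mono : ∀ {x y} → x < y → f x < f y) where

  Peak-map⁺ : ∀ {w x} → Peak w x → Peak (map f w) (f x)
  Peak-map⁺ (here a<b c<b) = here (f-mono a<b) (f-mono c<b)
  Peak-map⁺ (there pk)     = there (Peak-map⁺ pk)

module _ {m n} {f : Fin m → Fin n} (f-reflects : ∀ {x y} → f x < f y → x < y)
         (f-injective : ∀ {x y} → f x ≡ f y → x ≡ y) where

  Peak-map⁻ : ∀ w {x y} → Peak (map f w) y → y ≡ f x → Peak w x
  Peak-map⁻ (a ∷ b ∷ c ∷ w) (here fa<fb fc<fb) fb≡fx with refl ← f-injective fb≡fx =
    here (f-reflects fa<fb) (f-reflects fc<fb)
  Peak-map⁻ (a ∷ w)         (there pk)         y≡fx = there (Peak-map⁻ w pk y≡fx)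

peakSet-insertMax : ∀ {m} pre {a b : Fin m} post → Unique (pre ++ a ∷ b ∷ post) →
  peakSet (map inject₁ (pre ++ [ a ]) ++ fromℕ m ∷ map inject₁ (b ∷ post))
    ≡ (peakSet (pre ++ a ∷ b ∷ post) ∖ a ∖ b) ∷ʳ inside
peakSet-insertMax {m} pre {a} {b} post w! = ⊆-antisym ⊆ ⊇
  where
  M : Fin (suc m)
  M = fromℕ m
  w : List (Fin m)
  w = pre ++ a ∷ b ∷ post
  ↑ : List (Fin m) → List (Fin (suc m))
  ↑ = map inject₁

  ↑w≡ : ↑ w ≡ ↑ pre ++ inject₁ a ∷ inject₁ b ∷ ↑ post
  ↑w≡ = map-++ inject₁ pre (a ∷ b ∷ post)

  σ≡ : ↑ (pre ++ [ a ]) ++ M ∷ ↑ (b ∷ post) ≡ ↑ pre ++ inject₁ a ∷ M ∷ inject₁ b ∷ ↑ post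
  σ≡ = trans (cong (_++ M ∷ ↑ (b ∷ post)) (map-++ inject₁ pre [ a ])) (++-assoc (↑ pre) _ _)

  ↑w! : Unique (↑ pre ++ inject₁ a ∷ inject₁ b ∷ ↑ post)
  ↑w! = subst Unique ↑w≡ (Unique.map⁺ inject₁-injective w!)

  lift⁺ : ∀ {y} → Peak w y → Peak (↑ pre ++ inject₁ a ∷ inject₁ b ∷ ↑ post) (inject₁ y)
  lift⁺ = subst (λ v → Peak v _) ↑w≡ ∘ Peak-map⁺ inject₁-mono-<

  lift⁻ : ∀ {y} → Peak (↑ pre ++ inject₁ a ∷ inject₁ b ∷ ↑ post) (inject₁ y) → Peak w y
  lift⁻ pk = Peak-map⁻ inject₁-cancel-< inject₁-injective w (subst (λ v → Peak v _) (sym ↑w≡) pk) refl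

  ⊆ : ∀ {x} → x ∈ₛ peakSet (↑ (pre ++ [ a ]) ++ M ∷ ↑ (b ∷ post)) → x ∈ₛ (peakSet w ∖ a ∖ b) ∷ʳ inside
  ⊆ x∈ with Peak-insert⁻ M (↑ pre) (↑ post) ↑w! (inject₁<fromℕ a) (inject₁<fromℕ b)
              (subst (λ v → Peak v _) σ≡ (∈-peakSet⁻ x∈))
  ... | inj₁ refl = fromℕ∈∷ʳinside _
  ... | inj₂ (pk , x≢a , x≢b) with y , _ , refl ← ∈-map⁻ inject₁ (subst (_ ∈_) (sym ↑w≡) (Peak-∈ pk)) =
    inject₁∈∷ʳ⁺ (x∈p∧x≢y⇒x∈p-y (x∈p∧x≢y⇒x∈p-y (∈-peakSet⁺ (lift⁻ pk)) (x≢a ∘ cong inject₁)) (x≢b ∘ cong inject₁))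

  ⊇ : ∀ {x} → x ∈ₛ (peakSet w ∖ a ∖ b) ∷ʳ inside → x ∈ₛ peakSet (↑ (pre ++ [ a ]) ++ M ∷ ↑ (b ∷ post))
  ⊇ {x} x∈ = ∈-peakSet⁺ (subst (λ v → Peak v x) (sym σ≡) (peak x x∈ (fromℕ⊎inject₁ x)))
    where
    peak : ∀ x → x ∈ₛ (peakSet w ∖ a ∖ b) ∷ʳ inside → x ≡ M ⊎ ∃ (λ y → x ≡ inject₁ y) →
      Peak (↑ pre ++ inject₁ a ∷ M ∷ inject₁ b ∷ ↑ post) x
    peak _ _  (inj₁ refl) = Peak-insert-max M (↑ pre) (↑ post) (inject₁<fromℕ a) (inject₁<fromℕ b)
    peak _ x∈ (inj₂ (y , refl)) =
      Peak-insert⁺ M (↑ pre) (↑ post) (lift⁺ (∈-peakSet⁻ (x∈p-y⇒x∈p (x∈p-y⇒x∈p y∈))))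
        (x∈p-y⇒x≢y (x∈p-y⇒x∈p y∈) ∘ inject₁-injective) (x∈p-y⇒x≢y y∈ ∘ inject₁-injective)
      where y∈ = inject₁∈∷ʳ⁻ _ x∈

module _ {m : ℕ} (S : Subset m) where

  δ-insert : List (Fin m) → List (Fin m) → ℤ
  δ-insert u v = δ (peakSet (map inject₁ u ++ fromℕ m ∷ map inject₁ v)) (S ∷ʳ inside)

  private
    δ-insert-≡0 : ∀ u v → fromℕ m ∉ₛ peakSet (map inject₁ u ++ fromℕ m ∷ map inject₁ v) → δ-insert u v ≡ + 0
    δ-insert-≡0 u v M∉ = δ-≢ (λ P≡ → M∉ (subst (fromℕ m ∈ₛ_) (sym P≡) (fromℕ∈∷ʳinside S)))

  δ-insert-front : ∀ v → δ-insert [] v ≡ + 0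
  δ-insert-front v = δ-insert-≡0 [] v (fromℕ∉map-inject₁ v ∘ Peak-∈-tail ∘ ∈-peakSet⁻)

  δ-insert-back : ∀ u → δ-insert u [] ≡ + 0
  δ-insert-back u = δ-insert-≡0 u [] (fromℕ∉map-inject₁ u ∘ Peak-∈-init (map inject₁ u) ∘ ∈-peakSet⁻)

  δ-insert-between : ∀ pre {a b} post → Unique (pre ++ a ∷ b ∷ post) →
    δ-insert (pre ++ [ a ]) (b ∷ post) ≡ δ (peakSet (pre ++ a ∷ b ∷ post) ∖ a ∖ b) S
  δ-insert-between pre post w! = δ-cong (mk⇔
    (λ e → ∷ʳ-injectiveˡ _ _ (trans (sym (peakSet-insertMax pre post w!)) e))
    (λ e → trans (peakSet-insertMax pre post w!) (cong (_∷ʳ inside) e)))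

  ∑-δ-insert-after : ∀ W → Unique W → ∀ pre a t → W ≡ pre ++ a ∷ t →
    ∑ (splits t) (λ (u , v) → δ-insert (pre ++ a ∷ u) v)
      ≡ ∑ (adjacent (a ∷ t)) (λ (x , y) → δ (peakSet W ∖ x ∖ y) S)
  ∑-δ-insert-after W W! pre a []      _ = cong (_+ + 0) (δ-insert-back (pre ++ [ a ]))
  ∑-δ-insert-after W W! pre a (b ∷ t) refl = cong₂ _+_ (δ-insert-between pre t W!) (begin
    ∑ (map (λ (u , v) → (b ∷ u , v)) (splits t)) (λ (u , v) → δ-insert (pre ++ a ∷ u) v)
      ≡⟨ ∑-map _ (splits t) _ ⟩
    ∑ (splits t) (λ (u , v) → δ-insert (pre ++ a ∷ b ∷ u) v)
      ≡⟨ ∑-cong (splits t) (λ (u , v) _ → cong (λ w → δ-insert w v) (sym (++-assoc pre [ a ] (b ∷ u)))) ⟩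
    ∑ (splits t) (λ (u , v) → δ-insert ((pre ++ [ a ]) ++ b ∷ u) v)
      ≡⟨ ∑-δ-insert-after W W! (pre ++ [ a ]) b t (sym (++-assoc pre [ a ] (b ∷ t))) ⟩
    ∑ (adjacent (b ∷ t)) (λ (x , y) → δ (peakSet W ∖ x ∖ y) S) ∎)
    where open ≡-Reasoning

  ∑-δ-insert : ∀ w → Unique w →
    ∑ (splits w) (λ (u , v) → δ-insert u v) ≡ ∑ (adjacent w) (λ (x , y) → δ (peakSet w ∖ x ∖ y) S)
  ∑-δ-insert []      _  = cong (_+ + 0) (δ-insert-front [])
  ∑-δ-insert (h ∷ t) w! = begin
    δ-insert [] (h ∷ t) + ∑ (map (λ (u , v) → (h ∷ u , v)) (splits t)) (λ (u , v) → δ-insert u v)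
      ≡⟨ cong₂ _+_ (δ-insert-front (h ∷ t)) (∑-map _ (splits t) _) ⟩
    + 0 + ∑ (splits t) (λ (u , v) → δ-insert (h ∷ u) v)
      ≡⟨ ℤ.+-identityˡ _ ⟩
    ∑ (splits t) (λ (u , v) → δ-insert ([] ++ h ∷ u) v)
      ≡⟨ ∑-δ-insert-after (h ∷ t) w! [] h t refl ⟩
    ∑ (adjacent (h ∷ t)) (λ (x , y) → δ (peakSet (h ∷ t) ∖ x ∖ y) S) ∎
    where open ≡-Reasoning

  ∑-insertMax-δ : ∀ {n} (v : Vec (Fin m) n) → Unique (toList v) →
    ∑ (allFin (suc n)) (λ k → δ (peakSet (toList (insertMax v k))) (S ∷ʳ inside))
      ≡ ∑ (adjacent (toList v)) (λ (x , y) → δ (peakSet (toList v) ∖ x ∖ y) S)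
  ∑-insertMax-δ v v! =
    trans (∑-insertAt inject₁ v (fromℕ m) (λ w → δ (peakSet w) (S ∷ʳ inside))) (∑-δ-insert (toList v) v!)

-- Counting the adjacent pairs whose removal leaves S

module _ {n : ℕ} (P S : Subset n) where

  δ₊ : Fin n → ℤ
  δ₊ j = if does (j ∈? S) then + 0 else δ P (S ∪ ⁅ j ⁆)

  δ₊-outside : ∀ {j} → j ∉ₛ P → δ₊ j ≡ + 0
  δ₊-outside {j} j∉P with j ∈? S
  ... | yes _ = refl
  ... | no  _ = δ-≢ (λ P≡ → j∉P (subst (j ∈ₛ_) (sym P≡) (x∈p∪q⁺ (inj₂ (x∈⁅x⁆ j)))))

  ∖-outside : ∀ {a b} → a ∉ₛ P → b ∉ₛ P → P ∖ a ∖ b ≡ P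
  ∖-outside {a} {b} a∉P b∉P = ⊆-antisym (x∈p-y⇒x∈p ∘ x∈p-y⇒x∈p)
    (λ x∈P → x∈p∧x≢y⇒x∈p-y (x∈p∧x≢y⇒x∈p-y x∈P (λ { refl → a∉P x∈P })) (λ { refl → b∉P x∈P }))

  δ-∖-one : ∀ {a b} → a ∈ₛ P → b ∉ₛ P → δ (P ∖ a ∖ b) S ≡ δ₊ a
  δ-∖-one {a} {b} a∈P b∉P with a ∈? S
  ... | yes a∈S =
    δ-≢ {P = P ∖ a ∖ b} {S} (λ P∖≡S → x∈p-y⇒x≢y (x∈p-y⇒x∈p (subst (a ∈ₛ_) (sym P∖≡S) a∈S)) refl)
  ... | no  a∉S = δ-cong (mk⇔ to from)
    where
    to : P ∖ a ∖ b ≡ S → P ≡ S ∪ ⁅ a ⁆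
    to P∖≡S = ⊆-antisym
      (λ {x} x∈P → x∈p∪q⁺ (case x ≟ᶠ a of λ where
        (yes refl) → inj₂ (x∈⁅x⁆ a)
        (no  x≢a)  → inj₁ (subst (x ∈ₛ_) P∖≡S
                             (x∈p∧x≢y⇒x∈p-y (x∈p∧x≢y⇒x∈p-y x∈P x≢a) (λ { refl → b∉P x∈P })))))
      (λ {x} x∈ → [ (λ x∈S → x∈p-y⇒x∈p (x∈p-y⇒x∈p (subst (x ∈ₛ_) (sym P∖≡S) x∈S)))
                  , (λ x∈⁅a⁆ → subst (_∈ₛ P) (sym (x∈⁅y⁆⇒x≡y a x∈⁅a⁆)) a∈P) ]′ (x∈p∪q⁻ S ⁅ a ⁆ x∈))
    from : P ≡ S ∪ ⁅ a ⁆ → P ∖ a ∖ b ≡ S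
    from P≡ = ⊆-antisym
      (λ {x} x∈ → [ (λ x∈S → x∈S) , (λ x∈⁅a⁆ → ⊥-elim (x∈p-y⇒x≢y (x∈p-y⇒x∈p x∈) (x∈⁅y⁆⇒x≡y a x∈⁅a⁆))) ]′
                    (x∈p∪q⁻ S ⁅ a ⁆ (subst (x ∈ₛ_) P≡ (x∈p-y⇒x∈p (x∈p-y⇒x∈p x∈)))))
      (λ {x} x∈S → x∈p∧x≢y⇒x∈p-y
        (x∈p∧x≢y⇒x∈p-y (subst (x ∈ₛ_) (sym P≡) (x∈p∪q⁺ (inj₁ x∈S))) (λ { refl → a∉S x∈S }))
        (λ { refl → b∉P (subst (x ∈ₛ_) (sym P≡) (x∈p∪q⁺ (inj₁ x∈S))) }))

  δ-∖-pair : ∀ {a b} → ¬ (a ∈ₛ P × b ∈ₛ P) →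
    δ (P ∖ a ∖ b) S ≡ δ P S + ((δ₊ a + (- δ P S) * ⟦ a ∈? P ⟧) + (δ₊ b + (- δ P S) * ⟦ b ∈? P ⟧))
  δ-∖-pair {a} {b} ¬both with a ∈? P | b ∈? P
  ... | yes a∈P | yes b∈P = ⊥-elim (¬both (a∈P , b∈P))
  ... | no  a∉P | no  b∉P rewrite ∖-outside a∉P b∉P | δ₊-outside a∉P | δ₊-outside b∉P =
    solve 1 (λ c → c := c :+ ((con (+ 0) :+ (:- c) :* con (+ 0)) :+ (con (+ 0) :+ (:- c) :* con (+ 0)))) refl (δ P S)
    where open +-*-Solver
  ... | yes a∈P | no  b∉P rewrite δ-∖-one a∈P b∉P | δ₊-outside b∉P =
    solve 2 (λ c h → h := c :+ ((h :+ (:- c) :* con (+ 1)) :+ (con (+ 0) :+ (:- c) :* con (+ 0)))) refl (δ P S) (δ₊ a)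
    where open +-*-Solver
  ... | no  a∉P | yes b∈P rewrite p─x─y≡p─y─x P a b | δ-∖-one b∈P a∉P | δ₊-outside a∉P =
    solve 2 (λ c h → h := c :+ ((con (+ 0) :+ (:- c) :* con (+ 0)) :+ (h :+ (:- c) :* con (+ 1)))) refl (δ P S) (δ₊ b)
    where open +-*-Solver

  ∑-adjacent-δ-∖ : ∀ h t → h ∷ t ↭ allFin n → h ∉ₛ P → last h t ∉ₛ P →
    (∀ {a b} → (a , b) ∈ adjacent (h ∷ t) → a ∈ₛ P → b ∈ₛ P → ⊥) →
    ∑ (adjacent (h ∷ t)) (λ (a , b) → δ (P ∖ a ∖ b) S)
      ≡ (+ length t - (+ 2) * (+ ∣ S ∣)) * δ P S + (+ 2) * ∑ (allFin n) δ₊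
  ∑-adjacent-δ-∖ h t w↭ h∉P last∉P no-adjacent-peaks = begin
    ∑ adj (λ (a , b) → δ (P ∖ a ∖ b) S)
      ≡⟨ ∑-cong adj (λ _ ab∈ → δ-∖-pair (λ (a∈ , b∈) → no-adjacent-peaks ab∈ a∈ b∈)) ⟩
    ∑ adj (λ (a , b) → c + (g a + g b))
      ≡⟨ trans (∑-distrib-+ adj (λ _ → c) _)
               (cong (_+_ (∑ adj (λ _ → c))) (∑-distrib-+ adj (g ∘ proj₁) (g ∘ proj₂))) ⟩
    ∑ adj (λ _ → c) + (∑ adj (g ∘ proj₁) + ∑ adj (g ∘ proj₂))
      ≡⟨ cong₂ _+_ (trans (∑-adjacent-proj₂ h t (λ _ → c)) (∑-const t c)) (cong₂ _+_ ∑g∘proj₁ ∑g∘proj₂) ⟩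
    c * + length t + (∑ (allFin n) g + ∑ (allFin n) g)
      ≡⟨ cong (λ z → c * + length t + (z + z)) ∑g ⟩
    c * + length t + ((H + (- c) * + ∣ S ∣) + (H + (- c) * + ∣ S ∣))
      ≡⟨ solve 4 (λ c L s H → c :* L :+ ((H :+ (:- c) :* s) :+ (H :+ (:- c) :* s))
                              := (L :- con (+ 2) :* s) :* c :+ con (+ 2) :* H) refl c (+ length t) (+ ∣ S ∣) H ⟩
    (+ length t - (+ 2) * (+ ∣ S ∣)) * c + (+ 2) * H ∎
    where
    open ≡-Reasoning
    open +-*-Solver using (solve; _:=_; _:+_; _:*_; _:-_; :-_; con)
    adj : List (Fin n × Fin n)
    adj = adjacent (h ∷ t)
    c H : ℤ
    c = δ P S
    H = ∑ (allFin n) δ₊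
    g : Fin n → ℤ
    g x = δ₊ x + (- c) * ⟦ x ∈? P ⟧

    g-outside : ∀ {x} → x ∉ₛ P → g x ≡ + 0
    g-outside {x} x∉P rewrite δ₊-outside x∉P | ⟦⟧-no (x ∈? P) x∉P =
      trans (ℤ.+-identityˡ _) (ℤ.*-zeroʳ (- c))

    ∑g∘proj₁ : ∑ adj (g ∘ proj₁) ≡ ∑ (allFin n) g
    ∑g∘proj₁ = begin
      ∑ adj (g ∘ proj₁)                     ≡⟨ ℤ.+-identityʳ _ ⟨
      ∑ adj (g ∘ proj₁) + + 0               ≡⟨ cong (_+_ (∑ adj (g ∘ proj₁))) (g-outside last∉P) ⟨
      ∑ adj (g ∘ proj₁) + g (last h t)      ≡⟨ ∑-adjacent-proj₁ h t g ⟩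
      ∑ (h ∷ t) g                           ≡⟨ ∑-↭ g w↭ ⟩
      ∑ (allFin n) g                        ∎

    ∑g∘proj₂ : ∑ adj (g ∘ proj₂) ≡ ∑ (allFin n) g
    ∑g∘proj₂ = begin
      ∑ adj (g ∘ proj₂)                     ≡⟨ ∑-adjacent-proj₂ h t g ⟩
      ∑ t g                                 ≡⟨ ℤ.+-identityˡ _ ⟨
      + 0 + ∑ t g                           ≡⟨ cong (_+ ∑ t g) (g-outside h∉P) ⟨
      ∑ (h ∷ t) g                           ≡⟨ ∑-↭ g w↭ ⟩
      ∑ (allFin n) g                        ∎

    -- c vanishes unless P = S, so |P| may be replaced by |S|
    ∑g : ∑ (allFin n) g ≡ H + (- c) * + ∣ S ∣
    ∑g = begin
      ∑ (allFin n) g                                        ≡⟨ ∑-distrib-+ (allFin n) δ₊ _ ⟩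
      H + ∑ (allFin n) (λ x → (- c) * ⟦ x ∈? P ⟧)           ≡⟨ cong (_+_ H) (*-distribˡ-∑ (- c) (allFin n) _) ⟩
      H + (- c) * ∑ (allFin n) (λ x → ⟦ x ∈? P ⟧)           ≡⟨ cong (λ z → H + (- c) * z) (∣p∣≡∑ P) ⟨
      H + (- c) * + ∣ P ∣                                   ≡⟨ cong (_+_ H) c∣P∣≡c∣S∣ ⟩
      H + (- c) * + ∣ S ∣                                   ∎
      where
      c∣P∣≡c∣S∣ : (- c) * + ∣ P ∣ ≡ (- c) * + ∣ S ∣
      c∣P∣≡c∣S∣ with δ-cases P S
      ... | inj₁ refl = refl
      ... | inj₂ c≡0  rewrite c≡0 = refl

∑-insertMax-δ-perm : ∀ m (S : Subset (suc m)) {τ} → τ ∈ perms (suc m) →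
  ∑ (allFin (suc (suc m))) (λ k → δ (CP (insertMax τ k)) (S ∷ʳ inside))
    ≡ (+ m - (+ 2) * (+ ∣ S ∣)) * δ (CP τ) S + (+ 2) * ∑ (allFin (suc m)) (δ₊ (CP τ) S)
∑-insertMax-δ-perm m S {h ∷ᵥ τ} τ∈ = begin
  ∑ (allFin (suc (suc m))) (λ k → δ (CP (insertMax (h ∷ᵥ τ) k)) (S ∷ʳ inside))
    ≡⟨ ∑-insertMax-δ S (h ∷ᵥ τ) τ! ⟩
  ∑ (adjacent (h ∷ toList τ)) (λ (a , b) → δ (P ∖ a ∖ b) S)
    ≡⟨ ∑-adjacent-δ-∖ P S h (toList τ) (perm↭allFin τ∈) h∉P last∉P no-adjacent-peaks ⟩
  (+ length (toList τ) - (+ 2) * (+ ∣ S ∣)) * δ P S + (+ 2) * ∑ (allFin (suc m)) (δ₊ P S)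
    ≡⟨ cong (λ l → (+ l - (+ 2) * (+ ∣ S ∣)) * δ P S + (+ 2) * ∑ (allFin (suc m)) (δ₊ P S)) (length-toList τ) ⟩
  (+ m - (+ 2) * (+ ∣ S ∣)) * δ P S + (+ 2) * ∑ (allFin (suc m)) (δ₊ P S) ∎
  where
  open ≡-Reasoning
  P : Subset (suc m)
  P = CP (h ∷ᵥ τ)
  τ! : Unique (h ∷ toList τ)
  τ! = ∈-perms⁻ τ∈
  h∉P : h ∉ₛ P
  h∉P = Unique-head τ! ∘ Peak-∈-tail ∘ ∈-peakSet⁻
  last∉P : last h (toList τ) ∉ₛ P
  last∉P = Peak-last τ! ∘ ∈-peakSet⁻
  no-adjacent-peaks : ∀ {a b} → (a , b) ∈ adjacent (h ∷ toList τ) → a ∈ₛ P → b ∈ₛ P → ⊥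
  no-adjacent-peaks ab∈ a∈P b∈P = Peak-adjacent τ! ab∈ (∈-peakSet⁻ a∈P) (∈-peakSet⁻ b∈P)

∑-perms-δ₊ : ∀ m (S : Subset m) →
  ∑ (perms m) (λ τ → (+ 2) * ∑ (allFin m) (δ₊ (CP τ) S))
    ≡ ∑ (allFin m) (λ j → if does (j ∈? S) then + 0 else (+ 2) * (+ cp m (S ∪ ⁅ j ⁆)))
∑-perms-δ₊ m S = begin
  ∑ (perms m) (λ τ → (+ 2) * ∑ (allFin m) (δ₊ (CP τ) S))   ≡⟨ *-distribˡ-∑ (+ 2) (perms m) _ ⟩
  (+ 2) * ∑ (perms m) (λ τ → ∑ (allFin m) (δ₊ (CP τ) S))   ≡⟨ cong (_*_ (+ 2)) (∑-comm (perms m) (allFin m) _) ⟩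
  (+ 2) * ∑ (allFin m) (λ j → ∑ (perms m) (λ τ → δ₊ (CP τ) S j))   ≡⟨ *-distribˡ-∑ (+ 2) (allFin m) _ ⟨
  ∑ (allFin m) (λ j → (+ 2) * ∑ (perms m) (λ τ → δ₊ (CP τ) S j))   ≡⟨ ∑-cong (allFin m) (λ j _ → count j) ⟩
  ∑ (allFin m) (λ j → if does (j ∈? S) then + 0 else (+ 2) * (+ cp m (S ∪ ⁅ j ⁆))) ∎
  where
  open ≡-Reasoning
  count : ∀ j → (+ 2) * ∑ (perms m) (λ τ → δ₊ (CP τ) S j)
                ≡ (if does (j ∈? S) then + 0 else (+ 2) * (+ cp m (S ∪ ⁅ j ⁆)))
  count j with j ∈? S
  ... | yes _ = cong (_*_ (+ 2)) (∑-zero (perms m))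
  ... | no  _ = cong (_*_ (+ 2)) (sym (cp≡∑δ m (S ∪ ⁅ j ⁆)))

lemma3p1 : (m : ℕ) → 2 ≤ m → (S : Subset m) →
    + cp (suc m) (S ∷ʳ inside)
    ≡ ((+ suc m) - + 2 - (+ 2) * (+ ∣ S ∣)) * (+ cp m S)
    + foldr _+_ (+ 0) (map (λ j → if does (j ∈? S) then + 0 else (+ 2) * (+ cp m (S ∪ ⁅ j ⁆))) (allFin m))
-- only 1 ≤ m is needed, to split off the first entry of a permutation of [m]
lemma3p1 (suc m) (s≤s _) S = begin
  + cp (suc (suc m)) (S ∷ʳ inside)
    ≡⟨ cp≡∑δ (suc (suc m)) (S ∷ʳ inside) ⟩
  ∑ (perms (suc (suc m))) (λ σ → δ (CP σ) (S ∷ʳ inside))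
    ≡⟨ ∑-perms-suc (suc m) _ ⟩
  ∑ (perms (suc m)) (λ τ → ∑ (allFin (suc (suc m))) (λ k → δ (CP (insertMax τ k)) (S ∷ʳ inside)))
    ≡⟨ ∑-cong (perms (suc m)) (λ _ τ∈ → ∑-insertMax-δ-perm m S τ∈) ⟩
  ∑ (perms (suc m)) (λ τ → coeff * δ (CP τ) S + (+ 2) * ∑ (allFin (suc m)) (δ₊ (CP τ) S))
    ≡⟨ ∑-distrib-+ (perms (suc m)) _ _ ⟩
  ∑ (perms (suc m)) (λ τ → coeff * δ (CP τ) S)
    + ∑ (perms (suc m)) (λ τ → (+ 2) * ∑ (allFin (suc m)) (δ₊ (CP τ) S))
    ≡⟨ cong₂ _+_ (trans (*-distribˡ-∑ coeff (perms (suc m)) _) (cong (_*_ coeff) (sym (cp≡∑δ (suc m) S))))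
                 (∑-perms-δ₊ (suc m) S) ⟩
  coeff * + cp (suc m) S
    + ∑ (allFin (suc m)) (λ j → if does (j ∈? S) then + 0 else (+ 2) * (+ cp (suc m) (S ∪ ⁅ j ⁆))) ∎
  where
  open ≡-Reasoning
  coeff : ℤ
  coeff = + m - (+ 2) * (+ ∣ S ∣)
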